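{- For a simple connected graph $G$ on vertex set $\{0,\dots,n\}$, $n\ge1$, the shortest vector of its Laplacian lattice under the simplicial distance function satisfies $\nu_\triangle(L_G)=1$.
   Context: $L_G\subset H_0=\{x\in\mathbb{R}^{n+1}:\sum_ix_i=0\}$ is the set of integer combinations of the rows of the Laplacian $Q(G)=D(G)-A(G)$. Let $\triangle\subset H_0$ be the convex hull of $t_0,\dots,t_n$, where $t_i$ has $i$-th coordinate $n$ and all others $-1$, and $d_\triangle(p,q)=\inf\{\lambda\ge0:q\in p+\lambda\triangle\}$; for $p,q\in H_0$, $d_\triangle(p,q)=|\min_i(q_i-p_i)|$. $\nu_\triangle(L)=\min\{d_\triangle(O,q):q\in L,q\ne O\}$. -}

module Defs where

open import Data.Nat using (ℕ; zero; suc; _≤_)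
open import Data.Fin using (Fin; zero; suc; _≟_)
open import Data.Bool using (Bool; true; false; if_then_else_)
open import Data.Integer as ℤ using (ℤ; +_; 0ℤ; _⊓_; ∣_∣)
open import Data.Product using (Σ; ∃; _×_; _,_)
open import Relation.Binary.PropositionalEquality using (_≡_)
open import Relation.Nullary using (¬_; does)

record SimpleGraph (n : ℕ) : Set where
  field
    adj   : Fin (suc n) → Fin (suc n) → Bool
    sym   : ∀ u v → adj u v ≡ adj v u
    loopless : ∀ v → adj v v ≡ false
open SimpleGraph public

data Walk {n : ℕ} (G : SimpleGraph n) : Fin (suc n) → Fin (suc n) → Set where
  nil  : ∀ {u} → Walk G u u
  cons : ∀ {u v w} → adj G u v ≡ true → Walk G v w → Walk G u w

Connected : ∀ {n} → SimpleGraph n → Set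
Connected G = ∀ u v → Walk G u v

sumFin : ∀ {k} → (Fin k → ℤ) → ℤ
sumFin {zero}  f = 0ℤ
sumFin {suc k} f = f zero ℤ.+ sumFin (λ i → f (suc i))

minFin : ∀ {k} → (Fin (suc k) → ℤ) → ℤ
minFin {zero}  f = f zero
minFin {suc k} f = f zero ⊓ minFin (λ i → f (suc i))

b2z : Bool → ℤ
b2z true  = + 1
b2z false = 0ℤ

degree : ∀ {n} → SimpleGraph n → Fin (suc n) → ℤ
degree G i = sumFin (λ j → b2z (adj G i j))

laplacian : ∀ {n} → SimpleGraph n → Fin (suc n) → Fin (suc n) → ℤ
laplacian G i j = (if does (i ≟ j) then degree G i else 0ℤ) ℤ.- b2z (adj G i j)

Point : ℕ → Set
Point n = Fin (suc n) → ℤ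

IsZero : ∀ {n} → Point n → Set
IsZero q = ∀ j → q j ≡ 0ℤ

InLattice : ∀ {n} → SimpleGraph n → Point n → Set
InLattice {n} G q = Σ (Fin (suc n) → ℤ) λ c →
  ∀ j → q j ≡ sumFin (λ i → c i ℤ.* laplacian G i j)

-- Simplicial distance d_△(O,q) = |min_i q_i| for q ∈ H_0.
dTriangle : ∀ {n} → Point n → ℕ
dTriangle q = ∣ minFin q ∣

NuTriangleIs : ∀ {n} → SimpleGraph n → ℕ → Set
NuTriangleIs G k =
  (∃ λ q → InLattice G q × ¬ IsZero q × dTriangle q ≡ k)
  × (∀ q → InLattice G q → ¬ IsZero q → k ≤ dTriangle q)

module Submission where

-- Every row of the Laplacian sums to zero, so the lattice lies in H₀ and a nonzero
-- lattice point cannot be nonnegative: some coordinate is ≤ -1, i.e. d△(O,q) ≥ 1.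
-- Conversely, the row of a vertex is a lattice point whose off-diagonal entries are
-- 0 or -1, with a -1 at any neighbour, and connectivity (with n ≥ 1) supplies one.

open import Defs hiding (sym)
open import Data.Nat as ℕ using (ℕ; suc; _≤_; z≤n; s≤s)
open import Data.Fin using (Fin; zero; suc; _≟_)
open import Data.Bool using (true; false; if_then_else_)
open import Data.Integer using (ℤ; +_; -[1+_]; 0ℤ; 1ℤ; -1ℤ; _+_; _-_; -_; _*_; ∣_∣; +≤+)
  renaming (_≤_ to _≤ℤ_)
import Data.Integer.Properties as ℤ
open import Data.Product using (∃; _,_)
open import Relation.Binary.PropositionalEquality
open import Relation.Nullary using (¬_; does; yes; no; contradiction)
open import Algebra.Properties.Semiring.Sum ℤ.+-*-semiring
  using (sum; sum-cong-≗; sum-replicate-zero; sum-remove; ∑-distrib-+; ∑-comm; *-distribˡ-sum)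
open import Data.Vec.Functional using (removeAt)

sumFin≡sum : ∀ {k} (f : Fin k → ℤ) → sumFin f ≡ sum f
sumFin≡sum {ℕ.zero} f = refl
sumFin≡sum {suc k}  f = cong (_+_ (f zero)) (sumFin≡sum (λ i → f (suc i)))

sum-neg : ∀ {k} (f : Fin k → ℤ) → sum (λ i → - f i) ≡ - sum f
sum-neg f = begin
  sum (λ i → - f i)      ≡⟨ sum-cong-≗ (λ i → ℤ.-1*i≡-i (f i)) ⟨
  sum (λ i → -1ℤ * f i)  ≡⟨ *-distribˡ-sum -1ℤ f ⟨
  -1ℤ * sum f            ≡⟨ ℤ.-1*i≡-i (sum f) ⟩
  - sum f                ∎
  where open ≡-Reasoning

sum-δ : ∀ {k} (i : Fin k) (f : Fin k → ℤ) →
        sum (λ j → if does (i ≟ j) then f j else 0ℤ) ≡ f i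
sum-δ {suc k} zero    f = trans (cong (_+_ (f zero)) (sum-replicate-zero k)) (ℤ.+-identityʳ (f zero))
sum-δ {suc k} (suc i) f = trans (ℤ.+-identityˡ _) (sum-δ i (λ j → f (suc j)))

sum-nonneg : ∀ {k} (f : Fin k → ℤ) → (∀ i → 0ℤ ≤ℤ f i) → 0ℤ ≤ℤ sum f
sum-nonneg {ℕ.zero} f f≥0 = ℤ.≤-refl
sum-nonneg {suc k}  f f≥0 = ℤ.+-mono-≤ (f≥0 zero) (sum-nonneg (λ i → f (suc i)) (λ i → f≥0 (suc i)))

nonneg⇒≤sum : ∀ {k} (f : Fin (suc k) → ℤ) → (∀ i → 0ℤ ≤ℤ f i) → ∀ i → f i ≤ℤ sum f
nonneg⇒≤sum f f≥0 i = begin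
  f i                        ≡⟨ ℤ.+-identityʳ (f i) ⟨
  f i + 0ℤ                   ≤⟨ ℤ.+-monoʳ-≤ (f i) (sum-nonneg (removeAt f i) (λ j → f≥0 _)) ⟩
  f i + sum (removeAt f i)   ≡⟨ sum-remove f ⟨
  sum f                      ∎
  where open ℤ.≤-Reasoning

minFin≤ : ∀ {k} (f : Fin (suc k) → ℤ) i → minFin f ≤ℤ f i
minFin≤ {ℕ.zero} f zero    = ℤ.≤-refl
minFin≤ {suc k}  f zero    = ℤ.i⊓j≤i (f zero) _
minFin≤ {suc k}  f (suc i) = ℤ.≤-trans (ℤ.i⊓j≤j (f zero) _) (minFin≤ (λ j → f (suc j)) i)

minFin-greatest : ∀ {k} (f : Fin (suc k) → ℤ) {a} → (∀ i → a ≤ℤ f i) → a ≤ℤ minFin f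
minFin-greatest {ℕ.zero} f a≤f = a≤f zero
minFin-greatest {suc k}  f a≤f =
  ℤ.⊓-glb (a≤f zero) (minFin-greatest (λ i → f (suc i)) (λ i → a≤f (suc i)))

b2z-nonneg : ∀ b → 0ℤ ≤ℤ b2z b
b2z-nonneg true  = +≤+ z≤n
b2z-nonneg false = +≤+ z≤n

b2z≤1 : ∀ b → b2z b ≤ℤ 1ℤ
b2z≤1 true  = +≤+ (s≤s z≤n)
b2z≤1 false = +≤+ z≤n

laplacian-row-sum : ∀ {n} (G : SimpleGraph n) i → sum (laplacian G i) ≡ 0ℤ
laplacian-row-sum G i = begin
  sum (laplacian G i)
    ≡⟨ ∑-distrib-+ (λ j → if does (i ≟ j) then degree G i else 0ℤ) (λ j → - b2z (adj G i j)) ⟩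
  sum (λ j → if does (i ≟ j) then degree G i else 0ℤ) + sum (λ j → - b2z (adj G i j))
    ≡⟨ cong₂ _+_ (sum-δ i (λ _ → degree G i)) (sum-neg (λ j → b2z (adj G i j))) ⟩
  degree G i - sum (λ j → b2z (adj G i j))
    ≡⟨ cong (_-_ (degree G i)) (sumFin≡sum (λ j → b2z (adj G i j))) ⟨
  degree G i - degree G i
    ≡⟨ ℤ.+-inverseʳ (degree G i) ⟩
  0ℤ ∎
  where open ≡-Reasoning

lattice⇒sum≡0 : ∀ {n} (G : SimpleGraph n) {q} → InLattice G q → sum q ≡ 0ℤ
lattice⇒sum≡0 {n} G {q} (c , q≡cQ) = begin
  sum q
    ≡⟨ sum-cong-≗ (λ j → trans (q≡cQ j) (sumFin≡sum (λ i → c i * laplacian G i j))) ⟩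
  sum (λ j → sum (λ i → c i * laplacian G i j))
    ≡⟨ ∑-comm (λ i j → c i * laplacian G i j) ⟨
  sum (λ i → sum (λ j → c i * laplacian G i j))
    ≡⟨ sum-cong-≗ (λ i → *-distribˡ-sum (c i) (laplacian G i)) ⟨
  sum (λ i → c i * sum (laplacian G i))
    ≡⟨ sum-cong-≗ (λ i → trans (cong (_*_ (c i)) (laplacian-row-sum G i)) (ℤ.*-zeroʳ (c i))) ⟩
  sum {suc n} (λ _ → 0ℤ)
    ≡⟨ sum-replicate-zero (suc n) ⟩
  0ℤ ∎
  where open ≡-Reasoning

nonneg-lattice-point⇒zero : ∀ {n} (G : SimpleGraph n) {q} →
                            InLattice G q → (∀ j → 0ℤ ≤ℤ q j) → IsZero q
nonneg-lattice-point⇒zero G {q} q∈L q≥0 j =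
  ℤ.≤-antisym (subst (q j ≤ℤ_) (lattice⇒sum≡0 G q∈L) (nonneg⇒≤sum q q≥0 j)) (q≥0 j)

1≤dTriangle : ∀ {n} (G : SimpleGraph n) {q} → InLattice G q → ¬ IsZero q → 1 ≤ dTriangle q
1≤dTriangle G {q} q∈L q≢0 with minFin q in min≡
... | -[1+ m ] = s≤s z≤n
... | + m      = contradiction (nonneg-lattice-point⇒zero G q∈L q≥0) q≢0
  where
  q≥0 : ∀ j → 0ℤ ≤ℤ q j
  q≥0 j = ℤ.≤-trans (+≤+ z≤n) (subst (_≤ℤ q j) min≡ (minFin≤ q j))

row∈lattice : ∀ {n} (G : SimpleGraph n) i → InLattice G (laplacian G i)
row∈lattice G i = δᵢ , λ j → sym (begin
  sumFin (λ k → δᵢ k * laplacian G k j)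
    ≡⟨ sumFin≡sum (λ k → δᵢ k * laplacian G k j) ⟩
  sum (λ k → δᵢ k * laplacian G k j)
    ≡⟨ sum-cong-≗ (λ k → δ*-selects (does (i ≟ k)) (laplacian G k j)) ⟩
  sum (λ k → if does (i ≟ k) then laplacian G k j else 0ℤ)
    ≡⟨ sum-δ i (λ k → laplacian G k j) ⟩
  laplacian G i j ∎)
  where
  open ≡-Reasoning
  δᵢ : Fin _ → ℤ
  δᵢ k = if does (i ≟ k) then 1ℤ else 0ℤ
  δ*-selects : ∀ b x → (if b then 1ℤ else 0ℤ) * x ≡ (if b then x else 0ℤ)
  δ*-selects true  x = ℤ.*-identityˡ x
  δ*-selects false x = ℤ.*-zeroˡ x

-1≤laplacian : ∀ {n} (G : SimpleGraph n) i j → -1ℤ ≤ℤ laplacian G i j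
-1≤laplacian G i j = ℤ.+-mono-≤ (diagonal≥0 (does (i ≟ j))) (ℤ.neg-mono-≤ (b2z≤1 (adj G i j)))
  where
  diagonal≥0 : ∀ b → 0ℤ ≤ℤ (if b then degree G i else 0ℤ)
  diagonal≥0 true  = subst (0ℤ ≤ℤ_) (sym (sumFin≡sum (λ k → b2z (adj G i k))))
                       (sum-nonneg (λ k → b2z (adj G i k)) (λ k → b2z-nonneg (adj G i k)))
  diagonal≥0 false = ℤ.≤-refl

laplacian-adj : ∀ {n} (G : SimpleGraph n) {i j} → adj G i j ≡ true → laplacian G i j ≡ -1ℤ
laplacian-adj G {i} {j} i~j with i ≟ j
... | yes refl = contradiction (trans (sym i~j) (loopless G i)) λ ()
... | no _ rewrite i~j = refl

minFin-row : ∀ {n} (G : SimpleGraph n) {i j} → adj G i j ≡ true → minFin (laplacian G i) ≡ -1ℤ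
minFin-row G {i} {j} i~j = ℤ.≤-antisym
  (subst (minFin (laplacian G i) ≤ℤ_) (laplacian-adj G i~j) (minFin≤ (laplacian G i) j))
  (minFin-greatest (laplacian G i) (-1≤laplacian G i))

row≢0 : ∀ {n} (G : SimpleGraph n) {i j} → adj G i j ≡ true → ¬ IsZero (laplacian G i)
row≢0 G {j = j} i~j row≡0 with trans (sym (laplacian-adj G i~j)) (row≡0 j)
... | ()

walk-first-step : ∀ {n} {G : SimpleGraph n} {u v} → Walk G u v → u ≢ v → ∃ λ w → adj G u w ≡ true
walk-first-step nil                u≢u = contradiction refl u≢u
walk-first-step (cons {v = w} u~w _) _ = w , u~w

mainTheorem7 : ∀ (n : ℕ) → 1 ≤ n → (G : SimpleGraph n) → Connected G →
    NuTriangleIs G 1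
mainTheorem7 (suc n) _ G connected with walk-first-step (connected zero (suc zero)) (λ ())
... | w , 0~w =
  (laplacian G zero , row∈lattice G zero , row≢0 G 0~w , cong ∣_∣ (minFin-row G 0~w)) , λ _ → 1≤dTriangle G
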